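{- For all $w \in \mathfrak{B}_n$, $\operatorname{cdes}(w) = |\operatorname{CDes}(w)|$.
   Context: $\mathfrak{B}_n$ is the group of bijections $w$ of $[\![n]\!] := \{ -n,\dots,-1,1,\dots,n\}$ with $w(-i)=-w(i)$; it acts linearly on $\mathbb{R}^n$ by $w(e_i) := e_{w(i)}$, where $e_{ -j} := -e_j$. Type $C_n$ roots: $\Phi^+ = \{e_j\pm e_i : 1\le i<j\le n\}\cup\{2e_i\}$, $\Phi^- = -\Phi^+$; simple roots $\alpha_1 = 2e_1$, $\alpha_i = e_i - e_{i-1}$ ($2\le i\le n$); highest root $\theta = 2e_n = \alpha_1 + 2\alpha_2+\dots+2\alpha_n$; $\alpha_0 := -\theta$. For $i = 0,\dots,n$, $d_i(w) := 1$ if $w(\alpha_i) \in \Phi^-$ and $0$ otherwise. The Lam–Postnikov circular descent number is $\operatorname{cdes}(w) := d_0(w) + d_1(w) + 2d_2(w) + \dots + 2d_n(w)$. Order $[\![n]\!]$ by $-n < \dots < -1 < 1 < \dots < n$; the cyclic successor $i^+$ of $i$ is the next element, with $n^+ := -n$. $\operatorname{CDes}(w) := \{ i \in [\![n]\!] : w(i) > w(i^+)\}$. -}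

module Defs where

open import Data.Bool using (Bool; true; false; if_then_else_)
open import Data.Nat as ℕ using (ℕ; zero; suc)
open import Data.Fin as Fin using (Fin; zero; suc; toℕ; fromℕ; fromℕ<; inject₁)
open import Data.Fin.Properties using () renaming (_≟_ to _≟ᶠ_)
open import Data.Integer as ℤ using (ℤ; +_; -[1+_])
open import Data.List as List using (List; []; _∷_; _++_; map; concatMap; filter; length; allFin)
open import Data.Nat.ListAction using (sum)
open import Data.Vec as Vec using (Vec; tabulate; zipWith; replicate)
open import Data.Vec.Properties using (≡-dec)
import Data.List.Membership.DecPropositional as DecMem
open import Relation.Nullary using (does)
open import Relation.Binary.PropositionalEquality using (_≡_)
open import Function.Definitions using (Bijective)

-- The set [[n]] = {-n,…,-1,1,…,n}:  pos k stands for k+1, neg k for -(k+1).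
data SInt (n : ℕ) : Set where
  pos : Fin n → SInt n
  neg : Fin n → SInt n

negate : ∀ {n} → SInt n → SInt n
negate (pos k) = neg k
negate (neg k) = pos k

value : ∀ {n} → SInt n → ℤ
value (pos k) = + suc (toℕ k)
value (neg k) = ℤ.- (+ suc (toℕ k))

allSInt : (n : ℕ) → List (SInt n)
allSInt n = map pos (allFin n) ++ map neg (allFin n)

record SignedPerm (n : ℕ) : Set where
  field
    fn  : SInt n → SInt n
    bij : Bijective _≡_ _≡_ fn
    odd : ∀ i → fn (negate i) ≡ negate (fn i)
open SignedPerm public

-- cyclic successor i⁺ in the order -n < … < -1 < 1 < … < n, with n⁺ = -n
succ⁺ : ∀ {m} → SInt (suc m) → SInt (suc m)
succ⁺ (neg zero)    = pos zero
succ⁺ (neg (suc k)) = neg (inject₁ k)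
succ⁺ {m} (pos k) with suc (toℕ k) ℕ.<? suc m
... | Relation.Nullary.yes p = pos (fromℕ< p)
... | Relation.Nullary.no  _ = neg k

CDes : ∀ {m} → SignedPerm (suc m) → List (SInt (suc m))
CDes {m} w = filter (λ i → value (fn w (succ⁺ i)) ℤ.<? value (fn w i)) (allSInt (suc m))

-- ℤⁿ ⊂ ℝⁿ and the linear action of 𝔅ₙ (roots are integer vectors)

Vect : ℕ → Set
Vect n = Vec ℤ n

_⊕_ : ∀ {n} → Vect n → Vect n → Vect n
_⊕_ = zipWith ℤ._+_

_⊝_ : ∀ {n} → Vect n → Vect n → Vect n
_⊝_ = zipWith ℤ._-_

-1ℤ : ℤ
-1ℤ = -[1+ 0 ]

infixr 7 _·_
_·_ : ∀ {n} → ℤ → Vect n → Vect n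
c · v = Vec.map (c ℤ.*_) v

zeroV : ∀ {n} → Vect n
zeroV = replicate _ (+ 0)

-- standard basis eᵢ (coordinate k ↔ e_{k+1})
unit : ∀ {n} → Fin n → Vect n
unit k = tabulate (λ j → if does (j ≟ᶠ k) then + 1 else + 0)

e : ∀ {n} → SInt n → Vect n
e (pos k) = unit k
e (neg k) = -1ℤ · unit k

act : ∀ {n} → SignedPerm n → Vect n → Vect n
act {n} w v = List.foldr _⊕_ zeroV
  (map (λ i → Vec.lookup v i · e (fn w (pos i))) (allFin n))

Φ⁺ : (n : ℕ) → List (Vect n)
Φ⁺ n =
  concatMap (λ j → concatMap (λ i →
      if toℕ i ℕ.<ᵇ toℕ j then (unit j ⊝ unit i) ∷ (unit j ⊕ unit i) ∷ [] else [])
    (allFin n)) (allFin n)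
  ++ map (λ i → (+ 2) · unit i) (allFin n)

Φ⁻ : (n : ℕ) → List (Vect n)
Φ⁻ n = map (λ v → -1ℤ · v) (Φ⁺ n)

-- simple roots for n = suc m:  α₁ = 2e₁ ; α_{k+2} = e_{k+2} - e_{k+1} (k : Fin m)
α₁ : ∀ {m} → Vect (suc m)
α₁ = (+ 2) · unit zero

αₛ : ∀ {m} → Fin m → Vect (suc m)
αₛ k = unit (suc k) ⊝ unit (inject₁ k)

θ : ∀ {m} → Vect (suc m)
θ {m} = (+ 2) · unit (fromℕ m)

α₀ : ∀ {m} → Vect (suc m)
α₀ = -1ℤ · θ

d : ∀ {n} → SignedPerm n → Vect n → ℕ
d {n} w α = if does (act w α ∈? Φ⁻ n) then 1 else 0
  where open DecMem {A = Vect n} (≡-dec ℤ._≟_) using (_∈?_)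

cdes : ∀ {m} → SignedPerm (suc m) → ℕ
cdes {m} w = d w α₀ ℕ.+ d w α₁ ℕ.+ 2 ℕ.* sum (map (λ k → d w (αₛ k)) (allFin m))

module Submission where

-- Each term of cdes is d_w of a vector e_{i⁺} − e_i: α₀ = e_{-n} − e_n, α₁ = e_1 − e_{-1}, and
-- α_{k+1} = e_{k+1} − e_k = e_{-k} − e_{-(k+1)} arises both from i = k and from i = -(k+1), which is
-- where its coefficient 2 comes from. For X ≠ Y, e_X − e_Y is a root (2e_X when Y = -X) which is
-- negative exactly when X < Y, and w(e_X − e_Y) = e_{w(X)} − e_{w(Y)}; so d_w(e_{i⁺} − e_i) is the
-- indicator of w(i⁺) < w(i), that is of i ∈ CDes(w).

open import Defs
import Algebra.Properties.Semiring.Sum as SemiringSum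
open import Data.Bool using (true; false; T; if_then_else_)
open import Data.Fin using (Fin; zero; suc; toℕ; fromℕ; fromℕ<; inject₁; punchIn)
open import Data.Fin.Properties
  using (toℕ-injective; toℕ-fromℕ<; toℕ-fromℕ; toℕ-inject₁; toℕ<n; punchInᵢ≢i)
  renaming (_≟_ to _≟ᶠ_)
open import Data.Integer as ℤ using (ℤ; +_)
import Data.Integer.Properties as ℤP
open import Data.Integer.Tactic.RingSolver using (solve-∀)
open import Data.List as List using (List; []; _∷_; map; filter; length; allFin; concatMap)
import Data.List.Properties as List
import Data.List.Membership.DecPropositional as DecMem
open import Data.List.Membership.Propositional using (_∈_; _∉_; find; lose)
open import Data.List.Membership.Propositional.Properties
  using (∈-allFin; ∈-map⁺; ∈-map⁻; ∈-++⁺ˡ; ∈-++⁺ʳ; ∈-++⁻; ∈-concatMap⁺; ∈-concatMap⁻)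
open import Data.List.Relation.Unary.Any using (here; there)
open import Data.Nat as ℕ using (ℕ; zero; suc; s≤s; z≤n)
import Data.Nat.Properties as ℕP
open import Data.Nat.ListAction using (sum)
open import Data.Nat.ListAction.Properties using (sum-++)
open import Data.Nat.Tactic.RingSolver using () renaming (solve-∀ to solve-∀ℕ)
open import Data.Product using (_,_; proj₁)
open import Data.Sum using (inj₁; inj₂)
open import Data.Vec as Vec using (Vec; lookup)
import Data.Vec.Properties as Vec
import Data.Vec.Functional as Vector
open import Function using (_∘_; _⇔_; mk⇔)
open import Relation.Binary using (tri<; tri≈; tri>)
open import Relation.Binary.PropositionalEquality
open import Relation.Nullary using (Dec; yes; no; does; contradiction)
open import Relation.Nullary.Decidable using (dec-true; dec-false; does-⇔)

module ℕΣ = SemiringSum ℕP.+-*-semiring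
module ℤΣ = SemiringSum ℤP.+-*-semiring

indicator : ∀ {a} {A : Set a} → Dec A → ℕ
indicator a? = if does a? then 1 else 0

length-filter≡sum-indicator : ∀ {a p} {A : Set a} {P : A → Set p} (P? : ∀ x → Dec (P x))
  (xs : List A) → length (filter P? xs) ≡ sum (map (indicator ∘ P?) xs)
length-filter≡sum-indicator P? [] = refl
length-filter≡sum-indicator P? (x ∷ xs) with does (P? x)
... | true  = cong suc (length-filter≡sum-indicator P? xs)
... | false = length-filter≡sum-indicator P? xs

foldr-tabulate : ∀ {a b} {A : Set a} {B : Set b} (_∙_ : A → B → B) (ε : B) {n} (f : Fin n → A) →
  List.foldr _∙_ ε (List.tabulate f) ≡ Vector.foldr _∙_ ε f
foldr-tabulate _∙_ ε {zero}  f = refl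
foldr-tabulate _∙_ ε {suc n} f = cong (f zero ∙_) (foldr-tabulate _∙_ ε (f ∘ suc))

sum-map-allFin : ∀ {n} (f : Fin n → ℕ) → sum (map f (allFin n)) ≡ ℕΣ.sum f
sum-map-allFin f = trans (cong sum (List.map-tabulate (λ i → i) f)) (foldr-tabulate _ _ f)

lookup-ext : ∀ {a} {A : Set a} {n} {u v : Vec A n} → (∀ i → lookup u i ≡ lookup v i) → u ≡ v
lookup-ext {u = u} {v} eq =
  trans (sym (Vec.tabulate∘lookup u)) (trans (Vec.tabulate-cong eq) (Vec.tabulate∘lookup v))

⊝-to-⊕ : ∀ {n} (u v : Vect n) → u ⊝ v ≡ u ⊕ (-1ℤ · v)
⊝-to-⊕ Vec.[] Vec.[] = refl
⊝-to-⊕ (x Vec.∷ u) (y Vec.∷ v) = cong₂ Vec._∷_ (identity x y) (⊝-to-⊕ u v)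
  where
  identity : ∀ x y → x ℤ.- y ≡ x ℤ.+ -1ℤ ℤ.* y
  identity = solve-∀

⊝-swap : ∀ {n} (u v : Vect n) → u ⊝ v ≡ -1ℤ · (v ⊝ u)
⊝-swap Vec.[] Vec.[] = refl
⊝-swap (x Vec.∷ u) (y Vec.∷ v) = cong₂ Vec._∷_ (identity x y) (⊝-swap u v)
  where
  identity : ∀ x y → x ℤ.- y ≡ -1ℤ ℤ.* (y ℤ.- x)
  identity = solve-∀

-1·-involutive : ∀ {n} (v : Vect n) → -1ℤ · (-1ℤ · v) ≡ v
-1·-involutive Vec.[] = refl
-1·-involutive (x Vec.∷ v) = cong₂ Vec._∷_ (identity x) (-1·-involutive v)
  where
  identity : ∀ x → -1ℤ ℤ.* (-1ℤ ℤ.* x) ≡ x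
  identity = solve-∀

v⊕v≡2·v : ∀ {n} (v : Vect n) → v ⊕ v ≡ (+ 2) · v
v⊕v≡2·v Vec.[] = refl
v⊕v≡2·v (x Vec.∷ v) = cong₂ Vec._∷_ (identity x) (v⊕v≡2·v v)
  where
  identity : ∀ x → x ℤ.+ x ≡ + 2 ℤ.* x
  identity = solve-∀

u⊝-1·v≡u⊕v : ∀ {n} (u v : Vect n) → u ⊝ (-1ℤ · v) ≡ u ⊕ v
u⊝-1·v≡u⊕v u v = trans (⊝-to-⊕ u (-1ℤ · v)) (cong (u ⊕_) (-1·-involutive v))

v⊝-1·v≡2·v : ∀ {n} (v : Vect n) → v ⊝ (-1ℤ · v) ≡ (+ 2) · v
v⊝-1·v≡2·v v = trans (u⊝-1·v≡u⊕v v v) (v⊕v≡2·v v)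

⊕-comm : ∀ {n} (u v : Vect n) → u ⊕ v ≡ v ⊕ u
⊕-comm = Vec.zipWith-comm ℤP.+-comm

-1·u⊝-1·v≡v⊝u : ∀ {n} (u v : Vect n) → (-1ℤ · u) ⊝ (-1ℤ · v) ≡ v ⊝ u
-1·u⊝-1·v≡v⊝u u v = begin
  (-1ℤ · u) ⊝ (-1ℤ · v)   ≡⟨ u⊝-1·v≡u⊕v (-1ℤ · u) v ⟩
  (-1ℤ · u) ⊕ v           ≡⟨ ⊕-comm (-1ℤ · u) v ⟩
  v ⊕ (-1ℤ · u)           ≡⟨ ⊝-to-⊕ v u ⟨
  v ⊝ u                   ∎
  where open ≡-Reasoning

lookup-unit : ∀ {n} (k i : Fin n) → lookup (unit k) i ≡ (if does (i ≟ᶠ k) then + 1 else + 0)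
lookup-unit k = Vec.lookup∘tabulate _

lookup-⊕ : ∀ {n} (u v : Vect n) i → lookup (u ⊕ v) i ≡ lookup u i ℤ.+ lookup v i
lookup-⊕ u v i = Vec.lookup-zipWith _ i u v

lookup-· : ∀ {n} (a : ℤ) (v : Vect n) i → lookup (a · v) i ≡ a ℤ.* lookup v i
lookup-· a v i = Vec.lookup-map i _ v

pairing : ∀ {n} → (Fin n → ℤ) → Vect n → ℤ
pairing c v = ℤΣ.sum (λ i → lookup v i ℤ.* c i)

pairing-⊕ : ∀ {n} (c : Fin n → ℤ) (u v : Vect n) →
  pairing c (u ⊕ v) ≡ pairing c u ℤ.+ pairing c v
pairing-⊕ c u v = trans
  (ℤΣ.sum-cong-≗ λ i →
    trans (cong (ℤ._* c i) (lookup-⊕ u v i)) (ℤP.*-distribʳ-+ (c i) (lookup u i) (lookup v i)))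
  (ℤΣ.∑-distrib-+ (λ i → lookup u i ℤ.* c i) (λ i → lookup v i ℤ.* c i))

pairing-· : ∀ {n} (c : Fin n → ℤ) (a : ℤ) (v : Vect n) → pairing c (a · v) ≡ a ℤ.* pairing c v
pairing-· c a v = trans
  (ℤΣ.sum-cong-≗ λ i → trans (cong (ℤ._* c i) (lookup-· a v i)) (ℤP.*-assoc a _ _))
  (sym (ℤΣ.*-distribˡ-sum a (λ i → lookup v i ℤ.* c i)))

pairing-⊝ : ∀ {n} (c : Fin n → ℤ) (u v : Vect n) →
  pairing c (u ⊝ v) ≡ pairing c u ℤ.- pairing c v
pairing-⊝ c u v = begin
  pairing c (u ⊝ v)                          ≡⟨ cong (pairing c) (⊝-to-⊕ u v) ⟩
  pairing c (u ⊕ (-1ℤ · v))                  ≡⟨ pairing-⊕ c u (-1ℤ · v) ⟩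
  pairing c u ℤ.+ pairing c (-1ℤ · v)        ≡⟨ cong (λ x → pairing c u ℤ.+ x) (pairing-· c -1ℤ v) ⟩
  pairing c u ℤ.+ -1ℤ ℤ.* pairing c v        ≡⟨ cong (λ x → pairing c u ℤ.+ x) (ℤP.-1*i≡-i _) ⟩
  pairing c u ℤ.- pairing c v                ∎
  where open ≡-Reasoning

pairing-unit : ∀ {n} (c : Fin n → ℤ) (k : Fin n) → pairing c (unit k) ≡ c k
pairing-unit {suc n} c k = begin
  pairing c (unit k)                        ≡⟨ ℤΣ.sum-remove {i = k} term ⟩
  term k ℤ.+ ℤΣ.sum (Vector.removeAt term k) ≡⟨ cong₂ ℤ._+_ selected (ℤΣ.sum-cong-≗ others) ⟩
  c k ℤ.+ ℤΣ.sum (Vector.replicate n (+ 0))  ≡⟨ cong (λ x → c k ℤ.+ x) (ℤΣ.sum-replicate-zero n) ⟩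
  c k ℤ.+ + 0                                ≡⟨ ℤP.+-identityʳ (c k) ⟩
  c k                                        ∎
  where
  open ≡-Reasoning
  term : Fin (suc n) → ℤ
  term i = lookup (unit k) i ℤ.* c i
  selected : term k ≡ c k
  selected rewrite lookup-unit k k | dec-true (k ≟ᶠ k) refl = ℤP.*-identityˡ (c k)
  others : ∀ i → term (punchIn k i) ≡ + 0
  others i rewrite lookup-unit k (punchIn k i) | dec-false (punchIn k i ≟ᶠ k) (punchInᵢ≢i k i) =
    ℤP.*-zeroˡ (c (punchIn k i))

lookup-foldr-⊕ : ∀ {n k} (F : Fin k → Vect n) (j : Fin n) →
  lookup (Vector.foldr _⊕_ zeroV F) j ≡ ℤΣ.sum (λ i → lookup (F i) j)
lookup-foldr-⊕ {k = zero}  F j = Vec.lookup-replicate j (+ 0)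
lookup-foldr-⊕ {k = suc k} F j = trans (lookup-⊕ (F zero) _ j)
  (cong (λ x → lookup (F zero) j ℤ.+ x) (lookup-foldr-⊕ (F ∘ suc) j))

lookup-act : ∀ {n} (w : SignedPerm n) (v : Vect n) (j : Fin n) →
  lookup (act w v) j ≡ pairing (λ i → lookup (e (fn w (pos i))) j) v
lookup-act {n} w v j = begin
  lookup (List.foldr _⊕_ zeroV (map F (allFin n))) j
    ≡⟨ cong (λ xs → lookup (List.foldr _⊕_ zeroV xs) j) (List.map-tabulate (λ i → i) F) ⟩
  lookup (List.foldr _⊕_ zeroV (List.tabulate F)) j
    ≡⟨ cong (λ x → lookup x j) (foldr-tabulate _⊕_ zeroV F) ⟩
  lookup (Vector.foldr _⊕_ zeroV F) j
    ≡⟨ lookup-foldr-⊕ F j ⟩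
  ℤΣ.sum (λ i → lookup (F i) j)
    ≡⟨ ℤΣ.sum-cong-≗ (λ i → lookup-· (lookup v i) (e (fn w (pos i))) j) ⟩
  pairing (λ i → lookup (e (fn w (pos i))) j) v
    ∎
  where
  open ≡-Reasoning
  F : Fin n → Vect n
  F i = lookup v i · e (fn w (pos i))

act-⊝ : ∀ {n} (w : SignedPerm n) (u v : Vect n) → act w (u ⊝ v) ≡ act w u ⊝ act w v
act-⊝ w u v = lookup-ext λ j → trans (lookup-act w (u ⊝ v) j) (trans (pairing-⊝ _ u v)
  (sym (trans (Vec.lookup-zipWith _ j (act w u) (act w v))
              (cong₂ ℤ._-_ (lookup-act w u j) (lookup-act w v j)))))

act-· : ∀ {n} (w : SignedPerm n) (a : ℤ) (v : Vect n) → act w (a · v) ≡ a · act w v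
act-· w a v = lookup-ext λ j → trans (lookup-act w (a · v) j) (trans (pairing-· _ a v)
  (sym (trans (lookup-· a (act w v) j) (cong (a ℤ.*_) (lookup-act w v j)))))

act-unit : ∀ {n} (w : SignedPerm n) (k : Fin n) → act w (unit k) ≡ e (fn w (pos k))
act-unit w k = lookup-ext λ j → trans (lookup-act w (unit k) j) (pairing-unit _ k)

e-negate : ∀ {n} (X : SInt n) → e (negate X) ≡ -1ℤ · e X
e-negate (pos k) = refl
e-negate (neg k) = sym (-1·-involutive (unit k))

act-e : ∀ {n} (w : SignedPerm n) (X : SInt n) → act w (e X) ≡ e (fn w X)
act-e w (pos k) = act-unit w k
act-e w (neg k) = begin
  act w (-1ℤ · unit k)         ≡⟨ act-· w -1ℤ (unit k) ⟩
  -1ℤ · act w (unit k)         ≡⟨ cong (-1ℤ ·_) (act-unit w k) ⟩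
  -1ℤ · e (fn w (pos k))       ≡⟨ e-negate (fn w (pos k)) ⟨
  e (negate (fn w (pos k)))    ≡⟨ cong e (odd w (pos k)) ⟨
  e (fn w (neg k))             ∎
  where open ≡-Reasoning

act-e-⊝ : ∀ {n} (w : SignedPerm n) (X Y : SInt n) → act w (e X ⊝ e Y) ≡ e (fn w X) ⊝ e (fn w Y)
act-e-⊝ w X Y = trans (act-⊝ w (e X) (e Y)) (cong₂ _⊝_ (act-e w X) (act-e w Y))

pairs : ∀ {n} → Fin n → Fin n → List (Vect n)
pairs j i = if toℕ i ℕ.<ᵇ toℕ j then (unit j ⊝ unit i) ∷ (unit j ⊕ unit i) ∷ [] else []

pairs-∈Φ⁺ : ∀ {n} {r : Vect n} (j i : Fin n) → r ∈ pairs j i → r ∈ Φ⁺ n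
pairs-∈Φ⁺ {n} j i r∈ = ∈-++⁺ˡ (∈-concatMap⁺ (λ j → concatMap (pairs j) (allFin n)) {xs = allFin n}
  (lose (∈-allFin j) (∈-concatMap⁺ (pairs j) {xs = allFin n} (lose (∈-allFin i) r∈))))

∈-pairs : ∀ {n} {i j : Fin n} {r : Vect n} → toℕ i ℕ.< toℕ j →
  r ∈ (unit j ⊝ unit i) ∷ (unit j ⊕ unit i) ∷ [] → r ∈ pairs j i
∈-pairs {i = i} {j} i<j r∈ with toℕ i ℕ.<ᵇ toℕ j | ℕP.<⇒<ᵇ i<j
... | true | _ = r∈

unit-⊝-∈Φ⁺ : ∀ {n} {i j : Fin n} → toℕ i ℕ.< toℕ j → unit j ⊝ unit i ∈ Φ⁺ n
unit-⊝-∈Φ⁺ {i = i} {j} i<j = pairs-∈Φ⁺ j i (∈-pairs i<j (here refl))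

2·unit-∈Φ⁺ : ∀ {n} (i : Fin n) → (+ 2) · unit i ∈ Φ⁺ n
2·unit-∈Φ⁺ {n} i = ∈-++⁺ʳ (concatMap (λ j → concatMap (pairs j) (allFin n)) (allFin n))
  (∈-map⁺ (λ i → (+ 2) · unit i) (∈-allFin i))

unit-⊕-∈Φ⁺ : ∀ {n} (a b : Fin n) → unit a ⊕ unit b ∈ Φ⁺ n
unit-⊕-∈Φ⁺ a b with ℕP.<-cmp (toℕ a) (toℕ b)
... | tri< a<b _ _ =
  subst (_∈ Φ⁺ _) (⊕-comm (unit b) (unit a)) (pairs-∈Φ⁺ b a (∈-pairs a<b (there (here refl))))
... | tri> _ _ b<a = pairs-∈Φ⁺ a b (∈-pairs b<a (there (here refl)))
... | tri≈ _ a≡b _ rewrite toℕ-injective a≡b = subst (_∈ Φ⁺ _) (sym (v⊕v≡2·v (unit b))) (2·unit-∈Φ⁺ b)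

-- Pairing with ρ = (1, 2, …, n): positive on Φ⁺, hence negative on Φ⁻, so the two lists are disjoint.
height : ∀ {n} → Vect n → ℤ
height = pairing (λ i → + suc (toℕ i))

height-pairs : ∀ {n} {r : Vect n} (j i : Fin n) → r ∈ pairs j i → + 0 ℤ.< height r
height-pairs j i r∈ with toℕ i ℕ.<ᵇ toℕ j in i<ᵇj
height-pairs j i (here refl) | true = begin-strict
  + 0                                       <⟨ ℤ.+<+ (ℕP.m<n⇒0<n∸m i<j) ⟩
  + (toℕ j ℕ.∸ toℕ i)                       ≡⟨ ℤP.⊖-≥ (ℕP.<⇒≤ (ℕ.s≤s i<j)) ⟨
  suc (toℕ j) ℤ.⊖ suc (toℕ i)               ≡⟨ ℤP.m-n≡m⊖n (suc (toℕ j)) (suc (toℕ i)) ⟨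
  + suc (toℕ j) ℤ.- + suc (toℕ i)           ≡⟨ cong₂ ℤ._-_ (pairing-unit _ j) (pairing-unit _ i) ⟨
  height (unit j) ℤ.- height (unit i)       ≡⟨ pairing-⊝ _ (unit j) (unit i) ⟨
  height (unit j ⊝ unit i)                  ∎
  where
  open ℤP.≤-Reasoning
  i<j = ℕP.<ᵇ⇒< (toℕ i) (toℕ j) (subst T (sym i<ᵇj) _)
height-pairs j i (there (here refl)) | true = begin-strict
  + 0                                       <⟨ ℤ.+<+ (ℕ.s≤s z≤n) ⟩
  + suc (toℕ j) ℤ.+ + suc (toℕ i)           ≡⟨ cong₂ ℤ._+_ (pairing-unit _ j) (pairing-unit _ i) ⟨
  height (unit j) ℤ.+ height (unit i)       ≡⟨ pairing-⊕ _ (unit j) (unit i) ⟨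
  height (unit j ⊕ unit i)                  ∎
  where open ℤP.≤-Reasoning

height-Φ⁺ : ∀ {n} {r : Vect n} → r ∈ Φ⁺ n → + 0 ℤ.< height r
height-Φ⁺ {n} r∈ with ∈-++⁻ (concatMap (λ j → concatMap (pairs j) (allFin n)) (allFin n)) r∈
... | inj₁ r∈pairs
  with j , _ , r∈j ← find (∈-concatMap⁻ (λ j → concatMap (pairs j) (allFin n)) {xs = allFin n} r∈pairs)
  with i , _ , r∈ji ← find (∈-concatMap⁻ (pairs j) {xs = allFin n} r∈j)
  = height-pairs j i r∈ji
... | inj₂ r∈doubles with i , _ , refl ← ∈-map⁻ (λ i → (+ 2) · unit i) r∈doubles
  rewrite pairing-· (λ i → + suc (toℕ i)) (+ 2) (unit i) | pairing-unit (λ i → + suc (toℕ i)) i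
  = ℤ.+<+ (ℕ.s≤s z≤n)

Φ⁺-disjoint-Φ⁻ : ∀ {n} {r : Vect n} → r ∈ Φ⁺ n → r ∉ Φ⁻ n
Φ⁺-disjoint-Φ⁻ r∈Φ⁺ r∈Φ⁻ with r′ , r′∈Φ⁺ , refl ← ∈-map⁻ (λ v → -1ℤ · v) r∈Φ⁻ =
  ℤP.<-asym (height-Φ⁺ r∈Φ⁺) (begin-strict
    height (-1ℤ · r′)       ≡⟨ pairing-· _ -1ℤ r′ ⟩
    -1ℤ ℤ.* height r′       ≡⟨ ℤP.-1*i≡-i (height r′) ⟩
    ℤ.- height r′           <⟨ ℤP.neg-mono-< (height-Φ⁺ r′∈Φ⁺) ⟩
    + 0                     ∎)
  where open ℤP.≤-Reasoning

e-⊝-∈Φ⁺ : ∀ {n} (X Y : SInt n) → value Y ℤ.< value X → e X ⊝ e Y ∈ Φ⁺ n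
e-⊝-∈Φ⁺ (pos a) (pos b) (ℤ.+<+ (s≤s b<a)) = unit-⊝-∈Φ⁺ b<a
e-⊝-∈Φ⁺ (pos a) (neg b) _ = subst (_∈ Φ⁺ _) (sym (u⊝-1·v≡u⊕v (unit a) (unit b))) (unit-⊕-∈Φ⁺ a b)
e-⊝-∈Φ⁺ (neg a) (neg b) (ℤ.-<- a<b) =
  subst (_∈ Φ⁺ _) (sym (-1·u⊝-1·v≡v⊝u (unit a) (unit b))) (unit-⊝-∈Φ⁺ a<b)

e-⊝-∈Φ⁻ : ∀ {n} (X Y : SInt n) → value X ℤ.< value Y → e X ⊝ e Y ∈ Φ⁻ n
e-⊝-∈Φ⁻ X Y X<Y =
  subst (_∈ Φ⁻ _) (sym (⊝-swap (e X) (e Y))) (∈-map⁺ (-1ℤ ·_) (e-⊝-∈Φ⁺ Y X X<Y))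

value-injective : ∀ {n} {X Y : SInt n} → value X ≡ value Y → X ≡ Y
value-injective {X = pos a} {pos b} eq = cong pos (toℕ-injective (ℕP.suc-injective (ℤP.+-injective eq)))
value-injective {X = neg a} {neg b} eq = cong neg (toℕ-injective (ℤP.-[1+-injective eq))

e-⊝-∈Φ⁻⇔< : ∀ {n} {X Y : SInt n} → X ≢ Y → (e X ⊝ e Y ∈ Φ⁻ n) ⇔ (value X ℤ.< value Y)
e-⊝-∈Φ⁻⇔< {X = X} {Y} X≢Y = mk⇔ to (e-⊝-∈Φ⁻ X Y)
  where
  to : e X ⊝ e Y ∈ Φ⁻ _ → value X ℤ.< value Y
  to ∈Φ⁻ with ℤP.<-cmp (value X) (value Y)
  ... | tri< X<Y _ _ = X<Y
  ... | tri≈ _ X≡Y _ = contradiction (value-injective X≡Y) X≢Y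
  ... | tri> _ _ Y<X = contradiction ∈Φ⁻ (Φ⁺-disjoint-Φ⁻ (e-⊝-∈Φ⁺ X Y Y<X))

d-e-⊝ : ∀ {n} (w : SignedPerm n) {X Y : SInt n} → X ≢ Y →
  d w (e X ⊝ e Y) ≡ indicator (value (fn w X) ℤ.<? value (fn w Y))
d-e-⊝ {n} w {X} {Y} X≢Y = cong (λ b → if b then 1 else 0)
  (does-⇔ ∈Φ⁻⇔< (act w (e X ⊝ e Y) ∈? Φ⁻ n) (value (fn w X) ℤ.<? value (fn w Y)))
  where
  open DecMem {A = Vect n} (Vec.≡-dec ℤ._≟_) using (_∈?_)
  wX≢wY : fn w X ≢ fn w Y
  wX≢wY = X≢Y ∘ proj₁ (bij w)
  ∈Φ⁻⇔< : (act w (e X ⊝ e Y) ∈ Φ⁻ _) ⇔ (value (fn w X) ℤ.< value (fn w Y))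
  ∈Φ⁻⇔< = subst (λ v → (v ∈ Φ⁻ _) ⇔ (value (fn w X) ℤ.< value (fn w Y)))
    (sym (act-e-⊝ w X Y)) (e-⊝-∈Φ⁻⇔< wX≢wY)

descent : ∀ {m} → SignedPerm (suc m) → SInt (suc m) → ℕ
descent w i = indicator (value (fn w (succ⁺ i)) ℤ.<? value (fn w i))

length-CDes : ∀ {m} (w : SignedPerm (suc m)) → length (CDes w) ≡ sum (map (descent w) (allSInt (suc m)))
length-CDes {m} w =
  length-filter≡sum-indicator (λ i → value (fn w (succ⁺ i)) ℤ.<? value (fn w i)) (allSInt (suc m))

pos-injective : ∀ {n} {a b : Fin n} → pos a ≡ pos b → a ≡ b
pos-injective refl = refl

neg-injective : ∀ {n} {a b : Fin n} → neg a ≡ neg b → a ≡ b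
neg-injective refl = refl

succ⁺-≢ : ∀ {m} (i : SInt (suc m)) → succ⁺ i ≢ i
succ⁺-≢ (neg zero) ()
succ⁺-≢ (neg (suc k)) eq =
  ℕP.1+n≢n (trans (sym (cong toℕ (neg-injective eq))) (toℕ-inject₁ k))
succ⁺-≢ {m} (pos k) with suc (toℕ k) ℕ.<? suc m
... | yes p = λ eq → ℕP.1+n≢n (trans (sym (toℕ-fromℕ< p)) (cong toℕ (pos-injective eq)))
... | no _  = λ ()

succ⁺-inject₁ : ∀ {m} (k : Fin m) → succ⁺ (pos (inject₁ k)) ≡ pos (suc k)
succ⁺-inject₁ {m} k with suc (toℕ (inject₁ k)) ℕ.<? suc m
... | yes p = cong pos (toℕ-injective (trans (toℕ-fromℕ< p) (cong suc (toℕ-inject₁ k))))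
... | no ¬p = contradiction (ℕ.s≤s (subst (ℕ._< m) (sym (toℕ-inject₁ k)) (toℕ<n k))) ¬p

succ⁺-fromℕ : ∀ {m} → succ⁺ (pos (fromℕ m)) ≡ neg (fromℕ m)
succ⁺-fromℕ {m} with suc (toℕ (fromℕ m)) ℕ.<? suc m
... | yes p = contradiction (subst (λ x → suc x ℕ.< suc m) (toℕ-fromℕ m) p) (ℕP.<-irrefl refl)
... | no _  = refl

descent≡d : ∀ {m} (w : SignedPerm (suc m)) (i : SInt (suc m)) → descent w i ≡ d w (e (succ⁺ i) ⊝ e i)
descent≡d w i = sym (d-e-⊝ w (succ⁺-≢ i))

descent-inject₁ : ∀ {m} (w : SignedPerm (suc m)) (k : Fin m) → descent w (pos (inject₁ k)) ≡ d w (αₛ k)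
descent-inject₁ w k =
  trans (descent≡d w (pos (inject₁ k))) (cong (λ X → d w (e X ⊝ unit (inject₁ k))) (succ⁺-inject₁ k))

descent-neg-suc : ∀ {m} (w : SignedPerm (suc m)) (k : Fin m) → descent w (neg (suc k)) ≡ d w (αₛ k)
descent-neg-suc w k =
  trans (descent≡d w (neg (suc k))) (cong (d w) (-1·u⊝-1·v≡v⊝u (unit (inject₁ k)) (unit (suc k))))

descent-fromℕ : ∀ {m} (w : SignedPerm (suc m)) → descent w (pos (fromℕ m)) ≡ d w α₀
descent-fromℕ {m} w = begin
  descent w (pos (fromℕ m))                  ≡⟨ descent≡d w (pos (fromℕ m)) ⟩
  d w (e (succ⁺ (pos (fromℕ m))) ⊝ u)        ≡⟨ cong (λ X → d w (e X ⊝ u)) succ⁺-fromℕ ⟩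
  d w ((-1ℤ · u) ⊝ u)                        ≡⟨ cong (d w) (⊝-swap (-1ℤ · u) u) ⟩
  d w (-1ℤ · (u ⊝ (-1ℤ · u)))                ≡⟨ cong (λ v → d w (-1ℤ · v)) (v⊝-1·v≡2·v u) ⟩
  d w α₀                                     ∎
  where
  open ≡-Reasoning
  u = unit (fromℕ m)

descent-neg-zero : ∀ {m} (w : SignedPerm (suc m)) → descent w (neg zero) ≡ d w α₁
descent-neg-zero w = trans (descent≡d w (neg zero)) (cong (d w) (v⊝-1·v≡2·v (unit zero)))

sum-allSInt : ∀ {n} (f : SInt n → ℕ) →
  sum (map f (allSInt n)) ≡ ℕΣ.sum (f ∘ pos) ℕ.+ ℕΣ.sum (f ∘ neg)
sum-allSInt {n} f = begin
  sum (map f (map pos (allFin n) List.++ map neg (allFin n)))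
    ≡⟨ cong sum (List.map-++ f (map pos (allFin n)) _) ⟩
  sum (map f (map pos (allFin n)) List.++ map f (map neg (allFin n)))
    ≡⟨ sum-++ (map f (map pos (allFin n))) _ ⟩
  sum (map f (map pos (allFin n))) ℕ.+ sum (map f (map neg (allFin n)))
    ≡⟨ cong₂ ℕ._+_ (cong sum (List.map-∘ (allFin n))) (cong sum (List.map-∘ (allFin n))) ⟨
  sum (map (f ∘ pos) (allFin n)) ℕ.+ sum (map (f ∘ neg) (allFin n))
    ≡⟨ cong₂ ℕ._+_ (sum-map-allFin (f ∘ pos)) (sum-map-allFin (f ∘ neg)) ⟩
  ℕΣ.sum (f ∘ pos) ℕ.+ ℕΣ.sum (f ∘ neg)
    ∎
  where open ≡-Reasoning

lemma5p10 : (m : ℕ) (w : SignedPerm (suc m)) → cdes w ≡ length (CDes w)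
lemma5p10 m w = sym (begin
  length (CDes w)
    ≡⟨ length-CDes w ⟩
  sum (map (descent w) (allSInt (suc m)))
    ≡⟨ sum-allSInt (descent w) ⟩
  ℕΣ.sum (descent w ∘ pos) ℕ.+ ℕΣ.sum (descent w ∘ neg)
    ≡⟨ cong (ℕ._+ ℕΣ.sum (descent w ∘ neg)) (ℕΣ.sum-init-last (descent w ∘ pos)) ⟩
  (ℕΣ.sum (descent w ∘ pos ∘ inject₁) ℕ.+ descent w (pos (fromℕ m)))
    ℕ.+ (descent w (neg zero) ℕ.+ ℕΣ.sum (descent w ∘ neg ∘ suc))
    ≡⟨ cong₂ ℕ._+_ (cong₂ ℕ._+_ (ℕΣ.sum-cong-≗ (descent-inject₁ w)) (descent-fromℕ w))
                   (cong₂ ℕ._+_ (descent-neg-zero w) (ℕΣ.sum-cong-≗ (descent-neg-suc w))) ⟩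
  (S ℕ.+ d w α₀) ℕ.+ (d w α₁ ℕ.+ S)
    ≡⟨ rearrange S (d w α₀) (d w α₁) ⟩
  d w α₀ ℕ.+ d w α₁ ℕ.+ 2 ℕ.* S
    ≡⟨ cong (λ s → d w α₀ ℕ.+ d w α₁ ℕ.+ 2 ℕ.* s) (sum-map-allFin (d w ∘ αₛ)) ⟨
  cdes w
    ∎)
  where
  open ≡-Reasoning
  S = ℕΣ.sum (d w ∘ αₛ)
  rearrange : ∀ s a b → (s ℕ.+ a) ℕ.+ (b ℕ.+ s) ≡ a ℕ.+ b ℕ.+ 2 ℕ.* s
  rearrange = solve-∀ℕ
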